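{- Let $\mathcal{T}$ be a monotonic single-path loop as described in the context, and let $x[\vec r]\in\mathcal{L}$ be displacing. Then for all natural numbers $m\le n$, $x[\mathsf{up}^n(\vec r)]=\mathsf{up}^m(x)[\mathsf{up}^n(\vec r)]$ holds.
   Context: Variables and arrays: $\mathcal{V}$ is a countably infinite set of variables, each with an arity; $x$ denotes a function $\mathbb{Z}^{\mathsf{arity}(x)}\to\mathbb{Z}$ (arity $0$ = scalar). Rvalues: $r::=c\mid r\circ r\mid x[r_1,\ldots,r_k]$ ($c\in\mathbb{Z}$, $\circ$ arithmetic operator, $k=\mathsf{arity}(x)$). An lvalue is an rvalue of the form $x[\vec r]$. $\mathit{Lval}(r)$ = top-level lvalues of $r$: $\{r\}$ if $r$ is an lvalue, $\mathit{Lval}(r_1)\cup\mathit{Lval}(r_2)$ if $r=r_1\circ r_2$, $\emptyset$ for integers; unions for vectors. Expressions may contain if-then-else and $\lambda$-array expressions; an equation holds if true in every state. Loop $\mathcal{T}$: $\mathbf{while}\ \phi\ \mathbf{do}\ (\ell_1,\ldots,\ell_m)\leftarrow(r_1,\ldots,r_m)$, $\phi$ a conjunction of (in)equations over rvalues, $\ell_j=x_j[\vec r_j]$ lvalues with $x_i\ne x_j$ or $\vec r_i\ne\vec r_j$ for $i\ne j$, simultaneous update; $\vec\ell=(\ell_1,\ldots,\ell_m)$, $\mathsf{rhs}(x_j[\vec r_j]):=r_j$. Update: $\mathsf{up}_x(\text{empty})=x$; $\mathsf{up}_x(x[\vec r],\vec\ell')=\lambda\vec i.\ \mathbf{if}\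 \vec i=\vec r\ \mathbf{then}\ \mathsf{rhs}(x[\vec r])\ \mathbf{else}\ \mathsf{up}_x(\vec\ell')[\vec i]$ ($\vec i$ fresh); $\mathsf{up}_x(y[\vec r],\vec\ell')=\mathsf{up}_x(\vec\ell')$ for $y\ne x$. $\mathsf{up}=[x/\mathsf{up}_x(\vec\ell)\mid x\in\mathcal{V}]$ (componentwise on vectors); $\mathsf{up}^n$ its $n$-fold iteration. Monotonicity: vectors compared lexicographically (empty vectors equal); following the paper's convention that monotonic loops are increasing, $\mathcal{T}$ is monotonic if for every $x$, $\bigwedge_{x[\vec r]\in\vec\ell}\vec r\le\mathsf{up}(\vec r)$ is valid. Relevant lvalues: $\mathcal{L}$ is the smallest set with $\mathit{Lval}(r_j)\subseteq\mathcal{L}$ for all $j$ and $x[\vec r]\in\mathcal{L}\Rightarrow\mathit{Lval}(\vec r)\subseteq\mathcal{L}$. An lvalue $x[\vec r]\in\mathcal{L}$ is displacing if $\vec r'<\mathsf{up}(\vec r)$ is valid for all $\vec r'$ with $x[\vec r']\in\vec\ell$. -}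

module Defs where

open import Data.Nat using (ℕ; zero; suc)
open import Data.Integer as ℤ using (ℤ)
open import Data.Product using (Σ; _×_; _,_; proj₁; proj₂)
open import Data.Product.Properties using (≡-dec)
open import Data.Nat.Properties using () renaming (_≟_ to _≟ℕ_)
open import Data.Vec using (Vec; []; _∷_)
import Data.Vec.Properties as VecP
open import Data.List using (List; []; _∷_; map)
open import Data.List.Membership.Propositional using (_∈_)
open import Data.List.Relation.Unary.Any using (Any)
open import Data.List.Relation.Unary.Unique.Propositional using (Unique)
import Data.Vec.Relation.Unary.Any as VAny
open import Data.Vec.Relation.Binary.Lex.NonStrict using (Lex-<; Lex-≤)
open import Relation.Binary.PropositionalEquality using (_≡_; refl)
open import Relation.Nullary using (yes; no)
open import Function using (_∘_)

-- Variables: a name together with an arity.  For every arity there are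
-- countably many variables, so the set of variables is countably infinite.
Var : Set
Var = ℕ × ℕ

arity : Var → ℕ
arity = proj₂

_≟V_ : (x y : Var) → Relation.Nullary.Dec (x ≡ y)
_≟V_ = ≡-dec _≟ℕ_ _≟ℕ_

data Op : Set where
  plus minus times : Op

evalOp : Op → ℤ → ℤ → ℤ
evalOp plus  = ℤ._+_
evalOp minus = ℤ._-_
evalOp times = ℤ._*_

data Rval : Set where
  const : ℤ → Rval
  op    : Op → Rval → Rval → Rval
  arr   : (x : Var) → Vec Rval (arity x) → Rval

Lvalue : Set
Lvalue = Σ Var (λ x → Vec Rval (arity x))

State : Set
State = (x : Var) → Vec ℤ (arity x) → ℤ

mutual
  eval : State → Rval → ℤ
  eval σ (const c)   = c
  eval σ (op o r s)  = evalOp o (eval σ r) (eval σ s)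
  eval σ (arr x rs)  = σ x (evalVec σ rs)

  evalVec : State → ∀ {k} → Vec Rval k → Vec ℤ k
  evalVec σ []       = []
  evalVec σ (r ∷ rs) = eval σ r ∷ evalVec σ rs

-- top-level lvalues Lval(r), as membership predicates
mutual
  data _∈Lval_ : Lvalue → Rval → Set where
    here  : ∀ {x rs} → (x , rs) ∈Lval arr x rs
    left  : ∀ {l o r s} → l ∈Lval r → l ∈Lval op o r s
    right : ∀ {l o r s} → l ∈Lval s → l ∈Lval op o r s

_∈LvalV_ : ∀ {k} → Lvalue → Vec Rval k → Set
l ∈LvalV rs = VAny.Any (l ∈Lval_) rs

-- A single-path loop  while φ do (ℓ₁,…,ℓ_m) ← (r₁,…,r_m).
-- An atom of the guard φ is an (in)equation between rvalues.
data Rel : Set where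
  eq neq lt le gt ge : Rel

record Loop : Set where
  field
    guard   : List (Rval × Rel × Rval)
    updates : List (Lvalue × Rval)
    distinct : Unique (map proj₁ updates)

  lhs : List Lvalue
  lhs = map proj₁ updates

open Loop public

-- semantic effect of the substitution up = [x / up_x(ℓ⃗)]:
-- evaluating e·up in σ equals evaluating e in (upState σ).
upArr : State → List (Lvalue × Rval) → (x : Var) → Vec ℤ (arity x) → ℤ
upArr σ [] x is = σ x is
upArr σ (((y , rs) , r) ∷ us) x is with y ≟V x
... | no _ = upArr σ us x is
... | yes refl with VecP.≡-dec ℤ._≟_ is (evalVec σ rs)
...   | yes _ = eval σ r
...   | no _  = upArr σ us x is

upState : Loop → State → State
upState T σ = upArr σ (updates T)

upⁿ : Loop → ℕ → State → State
upⁿ T zero    σ = σ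
upⁿ T (suc n) σ = upState T (upⁿ T n σ)

_≤lex_ : ∀ {k} → Vec ℤ k → Vec ℤ k → Set
_≤lex_ = Lex-≤ _≡_ ℤ._≤_

_<lex_ : ∀ {k} → Vec ℤ k → Vec ℤ k → Set
_<lex_ = Lex-< _≡_ ℤ._≤_

Monotonic : Loop → Set
Monotonic T = ∀ {x} {rs : Vec Rval (arity x)} → (x , rs) ∈ lhs T →
              ∀ (σ : State) → evalVec σ rs ≤lex evalVec (upState T σ) rs

data Relevant (T : Loop) : Lvalue → Set where
  base : ∀ {l r ℓ} → (ℓ , r) ∈ updates T → l ∈Lval r → Relevant T l
  step : ∀ {l x rs} → Relevant T (x , rs) → l ∈LvalV rs → Relevant T l

Displacing : Loop → Lvalue → Set
Displacing T (x , rs) = ∀ (rs' : Vec Rval (arity x)) → (x , rs') ∈ lhs T →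
              ∀ (σ : State) → evalVec σ rs' <lex evalVec (upState T σ) rs

{-# OPTIONS --safe #-}
module Submission where

-- Monotonicity makes every index written for x in a step k < n lexicographically
-- at most its value in step n − 1, and displacement makes all of these strictly
-- smaller than r⃗ evaluated after step n.  So no step k < n writes x at up^n(r⃗),
-- and x there is unchanged by the first m ≤ n iterations.

open import Defs
open import Data.Nat using (ℕ; zero; suc; _≤_; _<_; _≤′_; ≤′-refl; ≤′-step; s≤s)
open import Data.Nat.Properties using (≤⇒≤′; <⇒≤)
open import Data.Vec using (Vec)
open import Data.Vec.Properties using (≡-dec)
open import Data.Product using (_×_; _,_; proj₁)
open import Data.List using (List; []; _∷_; map)
open import Data.List.Membership.Propositional using (_∈_)
open import Data.List.Relation.Unary.Any using (here; there)
open import Data.Empty using (⊥-elim)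
open import Function using (_∘_)
open import Relation.Nullary using (yes; no)
import Data.Integer as ℤ
import Data.Integer.Properties as ℤ
import Data.Vec.Relation.Binary.Lex.NonStrict as Lex
open import Data.Vec.Relation.Binary.Pointwise.Inductive using (≡⇒Pointwise-≡)
open import Relation.Binary.PropositionalEquality using (_≡_; _≢_; refl; sym; trans)

upArr-unwritten : ∀ σ (us : List (Lvalue × Rval)) x (v : Vec ℤ.ℤ (arity x)) →
                  (∀ {rs'} → (x , rs') ∈ map proj₁ us → evalVec σ rs' ≢ v) →
                  upArr σ us x v ≡ σ x v
upArr-unwritten σ [] x v unwritten = refl
upArr-unwritten σ (((y , rs) , r) ∷ us) x v unwritten with y ≟V x
... | no _ = upArr-unwritten σ us x v (unwritten ∘ there)
... | yes refl with ≡-dec ℤ._≟_ v (evalVec σ rs)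
...   | yes v≡rs = ⊥-elim (unwritten (here refl) (sym v≡rs))
...   | no _     = upArr-unwritten σ us x v (unwritten ∘ there)

module _ (T : Loop) (mono : Monotonic T) where

  upⁿ-monotonic : ∀ {x} {rs' : Vec Rval (arity x)} → (x , rs') ∈ lhs T →
                  ∀ σ {k j} → k ≤ j → evalVec (upⁿ T k σ) rs' ≤lex evalVec (upⁿ T j σ) rs'
  upⁿ-monotonic {rs' = rs'} written σ k≤j = go (≤⇒≤′ k≤j)
    where
    go : ∀ {k j} → k ≤′ j → evalVec (upⁿ T k σ) rs' ≤lex evalVec (upⁿ T j σ) rs'
    go ≤′-refl                    = Lex.≤-refl (≡⇒Pointwise-≡ refl)
    go {j = suc j} (≤′-step k≤′j) =
      Lex.≤-trans ℤ.≤-isPartialOrder (go k≤′j) (mono written (upⁿ T j σ))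

  module _ (x : Var) (rs : Vec Rval (arity x)) (disp : Displacing T (x , rs)) where

    displaced-beyond-writes : ∀ {rs'} → (x , rs') ∈ lhs T → ∀ σ {k n} → k < n →
                              evalVec (upⁿ T k σ) rs' <lex evalVec (upⁿ T n σ) rs
    displaced-beyond-writes written σ {n = suc n} (s≤s k≤n) =
      Lex.<-transʳ ℤ.≤-isPartialOrder (upⁿ-monotonic written σ k≤n)
                                      (disp _ written (upⁿ T n σ))

    upⁿ-suc-agrees-at-displaced : ∀ σ {k n} → k < n →
                                  upⁿ T (suc k) σ x (evalVec (upⁿ T n σ) rs)
                                    ≡ upⁿ T k σ x (evalVec (upⁿ T n σ) rs)
    upⁿ-suc-agrees-at-displaced σ {k} k<n =
      upArr-unwritten (upⁿ T k σ) (updates T) x _ λ written eq →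
        Lex.<-irrefl (≡⇒Pointwise-≡ eq) (displaced-beyond-writes written σ k<n)

    upⁿ-agrees-at-displaced : ∀ σ {m n} → m ≤ n →
                              upⁿ T m σ x (evalVec (upⁿ T n σ) rs)
                                ≡ σ x (evalVec (upⁿ T n σ) rs)
    upⁿ-agrees-at-displaced σ {zero}  _   = refl
    upⁿ-agrees-at-displaced σ {suc m} m<n =
      trans (upⁿ-suc-agrees-at-displaced σ m<n) (upⁿ-agrees-at-displaced σ (<⇒≤ m<n))

lemma3 : (T : Loop) → Monotonic T →
         (x : Defs.Var) (rs : Vec Rval (arity x)) →
         Relevant T (x , rs) → Displacing T (x , rs) →
         (m n : ℕ) → m ≤ n → (σ : State) →
         σ x (evalVec (upⁿ T n σ) rs) ≡ upⁿ T m σ x (evalVec (upⁿ T n σ) rs)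
lemma3 T mono x rs _ disp m n m≤n σ = sym (upⁿ-agrees-at-displaced T mono x rs disp σ m≤n)
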